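{- Let $PF$ be a parking function, $c$ a car not in $PF$, and $k\ge0$ such that the $(k+1)$-diagonal of $PF$ is empty and the $k$-diagonal of $PF$ contains no car smaller than $c$. Then $$\sum_{PF' \in \operatorname{Insert}(PF,c,k)} t^{\operatorname{area}(PF')} q^{\operatorname{dinv}(PF')} = t^{\operatorname{area}(PF)+k} q^{\operatorname{dinv}(PF)} \big[\, |\operatorname{Insert}(PF,c,k)| \,\big]_q,$$ where $[m]_q = 1+q+\dots+q^{m-1}$ (and $[0]_q=0$).
   Context: A Dyck path of size $n$ is a lattice path from $(0,0)$ to $(n,n)$ with unit North and East steps staying weakly above $y=x$. A parking function of size $n$ is a Dyck path of size $n$ together with $n$ distinct positive integers ("cars"), one in the cell immediately to the right of each North step, increasing from bottom to top within each column. The cell with lower-left corner $(i,j)$ lies in the $(j-i)$-diagonal. $\operatorname{area}(PF)$ is the number of full cells between the path and $y=x$ (equivalently the sum over cars of their diagonal numbers). A pair of cars $(s,b)$ with $s<b$ is a diagonal inversion if either $s,b$ lie in the same diagonal and $b$ is in a column to the right of $s$, or $b$ lies in the diagonal one above that of $s$ and $b$ is in a column to the left of $s$. $\operatorname{dinv}(PF)$ is the number of diagonal inversions. Insertion $\operatorname{Insert}(PF,c,k)$ (defined under the stated hypotheses on $PF,c,k$): the set of parking functions obtained in each of the following ways: (1) for each car $s<c$ in the $(k-1)$-diagonal: move all cars in rows higher than $s$ up and to the right by one, and place $c$ directly above $s$ (insert steps $NE$ immediately after the North step of $s$, with $c$ next to the new North step); (2) for each car $b>c$ in the $k$-diagonal: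 move all cars in rows higher than $b$ up and to the right by one, and place $c$ directly above and to the right of $b$ (insert $EN$ immediately after the North step of $b$, with $c$ next to the new North step); (3) if $k=0$: move all cars up and to the right by one and place $c$ in the lower-left corner (prepend $NE$, with $c$ next to the new North step). -}

module Defs where

open import Level using (Level)
open import Data.Nat using (ℕ; zero; suc; _+_; _≤_; _<_; _≡ᵇ_; _<ᵇ_)
open import Data.Bool using (Bool; true; false; if_then_else_; _∧_; _∨_)
open import Data.Product using (_×_; _,_; proj₁; proj₂)
open import Data.Unit using (⊤)
open import Data.List using (List; []; _∷_; _++_; map)
open import Relation.Binary.PropositionalEquality using (_≡_)
open import Algebra.Bundles using (CommutativeSemiring)

-- A parking function is encoded by its rows read from bottom to top.
-- Row i is a pair (car , diagonal): the car in row i and the diagonal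
-- number a_i of its cell (the cell with lower-left corner (i - a_i , i)).
Row : Set
Row = ℕ × ℕ

car : Row → ℕ
car = proj₁

diag : Row → ℕ
diag = proj₂

-- Consecutive-row conditions of the Dyck path / column condition:
-- a_{i+1} ≤ a_i + 1 (path stays weakly above y = x, one N step per row),
-- and if a_{i+1} = a_i + 1 the two cars are in the same column, so the
-- upper car is larger.
Steps : Row → List Row → Set
Steps _ [] = ⊤
Steps r (r' ∷ rs) = (diag r' ≤ suc (diag r)) × (diag r' ≡ suc (diag r) → car r < car r') × Steps r' rs

DyckRows : List Row → Set
DyckRows [] = ⊤
DyckRows (r ∷ rs) = (diag r ≡ 0) × Steps r rs

open import Data.List.Relation.Unary.All using (All)
open import Data.List.Relation.Unary.Unique.Propositional using (Unique)

IsPF : List Row → Set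
IsPF P = DyckRows P × All (λ r → 1 ≤ car r) P × Unique (map car P)

area : List Row → ℕ
area [] = 0
area (r ∷ rs) = diag r + area rs

-- For rows r (lower) and r' (higher), is (r , r') a diagonal inversion?
-- Same diagonal: the higher row is in a column to the right, so it is an
-- inversion iff car r < car r'.  Higher row one diagonal below the lower
-- row: then the lower row's car is in the diagonal one above and in a column
-- to the left, so it is an inversion iff car r' < car r.
isInv : Row → Row → Bool
isInv r r' = ((diag r ≡ᵇ diag r') ∧ (car r <ᵇ car r'))
           ∨ ((diag r ≡ᵇ suc (diag r')) ∧ (car r' <ᵇ car r))

count : (Row → Bool) → List Row → ℕ
count p [] = 0
count p (x ∷ xs) = (if p x then 1 else 0) + count p xs

dinv : List Row → ℕ
dinv [] = 0
dinv (r ∷ rs) = count (isInv r) rs + dinv rs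

-- Rules (1) and (2): insert a new row (c , k) directly after the row of a
-- car s < c in the (k-1)-diagonal, or of a car b > c in the k-diagonal.
-- Rows above keep their diagonal (they move up and right by one).
eligible : ℕ → ℕ → Row → Bool
eligible c k r = ((car r <ᵇ c) ∧ (suc (diag r) ≡ᵇ k)) ∨ ((c <ᵇ car r) ∧ (diag r ≡ᵇ k))

insRows : ℕ → ℕ → List Row → List (List Row)
insRows c k [] = []
insRows c k (r ∷ rs) =
  (if eligible c k r then (r ∷ (c , k) ∷ rs) ∷ [] else [])
  ++ map (r ∷_) (insRows c k rs)

-- Insert(PF, c, k), including rule (3) when k = 0.
Insert : List Row → ℕ → ℕ → List (List Row)
Insert P c k = (if k ≡ᵇ 0 then ((c , 0) ∷ P) ∷ [] else []) ++ insRows c k P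

module _ {a ℓ : Level} (R : CommutativeSemiring a ℓ) where
  open CommutativeSemiring R using (Carrier; 0#; 1#) renaming (_+_ to _⊕_; _*_ to _⊛_)

  pow : Carrier → ℕ → Carrier
  pow x zero = 1#
  pow x (suc n) = x ⊛ pow x n

  qint : Carrier → ℕ → Carrier
  qint q zero = 0#
  qint q (suc m) = 1# ⊕ (q ⊛ qint q m)

  sumR : List Carrier → Carrier
  sumR [] = 0#
  sumR (x ∷ xs) = x ⊕ sumR xs

  areaDinvGF : Carrier → Carrier → List (List Row) → Carrier
  areaDinvGF t q L = sumR (map (λ P → pow t (area P) ⊛ pow q (dinv P)) L)

module Submission where

-- Let e be the number of "insertion sites" of P, i.e. rows r
-- with eligible c k r (cars s < c in diagonal k-1 and cars b > c in
-- diagonal k).  By hypothesis no row of P forms a diagonal inversion with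
-- the new row (c , k) placed above it, while the new row forms an inversion
-- with a row above it exactly when that row is an insertion site.  Hence
-- inserting c just above the j-th site from the top (rules (1),(2)) adds
-- k to the area and j-1 to dinv, and rule (3) (k = 0) adds e to dinv.
-- So the (area , dinv) statistics of Insert(P,c,k), in list order, are
--   (area P + k , dinv P + i)   for i = N-1, N-2, ..., 0,
-- with N = |Insert(P,c,k)|, and summing t^area q^dinv gives the claim.

open import Defs
open import Level using (Level)
open import Data.Nat using (ℕ; _+_; _≤_; _<_; suc; zero; _≡ᵇ_; _<ᵇ_)
open import Data.Nat.Properties using (+-comm; +-assoc; +-identityʳ; ≡ᵇ⇒≡; <ᵇ⇒<)
open import Data.Bool using (Bool; true; false; if_then_else_; _∧_; _∨_; T)
open import Data.Bool.Properties using (∧-comm; ∨-comm; T-≡)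
open import Function.Bundles using (Equivalence)
open import Data.Product using (_×_; _,_; proj₁; proj₂; ∃)
open import Data.List using (List; map; length; []; _∷_; downFrom)
open import Data.List.Properties using (map-∘; map-cong; length-map; length-downFrom)
open import Data.List.Relation.Unary.All using (All; []; _∷_)
import Data.List.Relation.Unary.All as All
open import Data.List.Relation.Unary.All.Properties using (map⁺)
open import Data.List.Membership.Propositional using (_∉_)
open import Data.Empty using (⊥-elim)
open import Function using (_∘_)
open import Relation.Binary.PropositionalEquality
  using (_≡_; _≢_; refl; sym; trans; cong; cong₂; module ≡-Reasoning)
open import Relation.Nullary using (¬_)
open import Algebra.Bundles using (CommutativeSemiring)

≡ᵇ-sym : ∀ m n → (m ≡ᵇ n) ≡ (n ≡ᵇ m)
≡ᵇ-sym zero    zero    = refl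
≡ᵇ-sym zero    (suc n) = refl
≡ᵇ-sym (suc m) zero    = refl
≡ᵇ-sym (suc m) (suc n) = ≡ᵇ-sym m n

T-of : ∀ {b} → b ≡ true → T b
T-of = Equivalence.from T-≡

+-rearrange : ∀ x y z → x + (y + z) ≡ (x + z) + y
+-rearrange x y z = trans (cong (x +_) (+-comm y z)) (sym (+-assoc x z y))

module _ (c k : ℕ) where

  isInv-new-below : ∀ r → isInv (c , k) r ≡ eligible c k r
  isInv-new-below r = begin
    ((k ≡ᵇ diag r) ∧ (c <ᵇ car r)) ∨ ((k ≡ᵇ suc (diag r)) ∧ (car r <ᵇ c))
      ≡⟨ ∨-comm ((k ≡ᵇ diag r) ∧ (c <ᵇ car r)) _ ⟩
    ((k ≡ᵇ suc (diag r)) ∧ (car r <ᵇ c)) ∨ ((k ≡ᵇ diag r) ∧ (c <ᵇ car r))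
      ≡⟨ cong₂ _∨_ (∧-comm (k ≡ᵇ suc (diag r)) _) (∧-comm (k ≡ᵇ diag r) _) ⟩
    ((car r <ᵇ c) ∧ (k ≡ᵇ suc (diag r))) ∨ ((c <ᵇ car r) ∧ (k ≡ᵇ diag r))
      ≡⟨ cong₂ _∨_ (cong ((car r <ᵇ c) ∧_) (≡ᵇ-sym k (suc (diag r))))
                   (cong ((c <ᵇ car r) ∧_) (≡ᵇ-sym k (diag r))) ⟩
    ((car r <ᵇ c) ∧ (suc (diag r) ≡ᵇ k)) ∨ ((c <ᵇ car r) ∧ (diag r ≡ᵇ k)) ∎
    where open ≡-Reasoning

  count-isInv-new : ∀ rs → count (isInv (c , k)) rs ≡ count (eligible c k) rs
  count-isInv-new []       = refl
  count-isInv-new (r ∷ rs) =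
    cong₂ (λ b n → (if b then 1 else 0) + n) (isInv-new-below r) (count-isInv-new rs)

  no-inversion-with-new : ∀ r → diag r ≢ suc k → (diag r ≡ k → ¬ (car r < c))
                        → isInv r (c , k) ≡ false
  no-inversion-with-new r notAbove notSmaller
    with diag r ≡ᵇ suc k in isAbove | diag r ≡ᵇ k in sameDiag | car r <ᵇ c in smaller
  ... | true  | _     | _     = ⊥-elim (notAbove (≡ᵇ⇒≡ (diag r) (suc k) (T-of isAbove)))
  ... | false | false | _     = refl
  ... | false | true  | false = refl
  ... | false | true  | true  = ⊥-elim (notSmaller (≡ᵇ⇒≡ (diag r) k (T-of sameDiag))
                                                  (<ᵇ⇒< (car r) c (T-of smaller)))

  count-insRows : (p : Row → Bool) → p (c , k) ≡ false → ∀ rs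
                → All (λ L → count p L ≡ count p rs) (insRows c k rs)
  count-insRows p new [] = []
  count-insRows p new (r ∷ rs) with eligible c k r
  ... | true  = cong (λ b → (if p r then 1 else 0) + ((if b then 1 else 0) + count p rs)) new
                ∷ map⁺ (All.map (cong ((if p r then 1 else 0) +_)) (count-insRows p new rs))
  ... | false = map⁺ (All.map (cong ((if p r then 1 else 0) +_)) (count-insRows p new rs))

stats : List Row → ℕ × ℕ
stats L = area L , dinv L

stats-cons : ∀ r n (Ls : List (List Row)) → All (λ L → count (isInv r) L ≡ n) Ls
           → map stats (map (r ∷_) Ls)
             ≡ map (λ s → diag r + proj₁ s , n + proj₂ s) (map stats Ls)
stats-cons r n []       []       = refl
stats-cons r n (L ∷ Ls) (h ∷ hs) =
  cong₂ _∷_ (cong (λ m → diag r + area L , m + dinv L) h) (stats-cons r n Ls hs)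

-- Inserting c directly above row r (an insertion site): the new row sees
-- the e sites above it, and r sees no inversion with the new row.
stats-at-site : ∀ c k r rs → isInv r (c , k) ≡ false
  → stats (r ∷ (c , k) ∷ rs)
    ≡ ((diag r + area rs) + k , (count (isInv r) rs + dinv rs) + count (eligible c k) rs)
stats-at-site c k r rs noInv rewrite noInv | count-isInv-new c k rs =
  cong₂ _,_ (+-rearrange (diag r) k (area rs))
            (+-rearrange (count (isInv r) rs) (count (eligible c k) rs) (dinv rs))

-- Insertions above the bottom row r: r keeps its inversions, so the
-- statistics known for rs are shifted by (diag r , inversions of r).
stats-above-row : ∀ c k r rs → isInv r (c , k) ≡ false
  → map stats (insRows c k rs)
    ≡ map (λ i → area rs + k , dinv rs + i) (downFrom (count (eligible c k) rs))
  → map stats (map (r ∷_) (insRows c k rs))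
    ≡ map (λ i → (diag r + area rs) + k , (count (isInv r) rs + dinv rs) + i)
          (downFrom (count (eligible c k) rs))
stats-above-row c k r rs noInv statsRs = begin
  map stats (map (r ∷_) (insRows c k rs))
    ≡⟨ stats-cons r n (insRows c k rs) (count-insRows c k (isInv r) noInv rs) ⟩
  map shift (map stats (insRows c k rs))
    ≡⟨ cong (map shift) statsRs ⟩
  map shift (map (λ i → area rs + k , dinv rs + i) sites)
    ≡⟨ sym (map-∘ sites) ⟩
  map (λ i → diag r + (area rs + k) , n + (dinv rs + i)) sites
    ≡⟨ map-cong (λ i → cong₂ _,_ (sym (+-assoc (diag r) (area rs) k))
                                 (sym (+-assoc n (dinv rs) i))) sites ⟩
  map (λ i → (diag r + area rs) + k , (n + dinv rs) + i) sites ∎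
  where
  open ≡-Reasoning
  n = count (isInv r) rs
  sites = downFrom (count (eligible c k) rs)
  shift : ℕ × ℕ → ℕ × ℕ
  shift s = diag r + proj₁ s , n + proj₂ s

stats-insRows : ∀ c k rs → All (λ r → isInv r (c , k) ≡ false) rs
              → map stats (insRows c k rs)
                ≡ map (λ i → area rs + k , dinv rs + i) (downFrom (count (eligible c k) rs))
stats-insRows c k []       []               = refl
stats-insRows c k (r ∷ rs) (noInv ∷ noInvs) with eligible c k r
... | true  = cong₂ _∷_ (stats-at-site c k r rs noInv)
                        (stats-above-row c k r rs noInv (stats-insRows c k rs noInvs))
... | false = stats-above-row c k r rs noInv (stats-insRows c k rs noInvs)

-- The statistics of Insert(P, c, k): rule (3) (k = 0) contributes one
-- more row with dinv P + e, placed before the others in the list.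
stats-Insert : ∀ P c k → All (λ r → isInv r (c , k) ≡ false) P
  → ∃ λ N → map stats (Insert P c k) ≡ map (λ i → area P + k , dinv P + i) (downFrom N)
stats-Insert P c (suc k) noInv = count (eligible c (suc k)) P , stats-insRows c (suc k) P noInv
stats-Insert P c zero    noInv =
  suc (count (eligible c zero) P) , cong₂ _∷_ atBottom (stats-insRows c zero P noInv)
  where
  atBottom : stats ((c , 0) ∷ P) ≡ (area P + 0 , dinv P + count (eligible c zero) P)
  atBottom = cong₂ _,_ (sym (+-identityʳ (area P)))
                       (trans (cong (_+ dinv P) (count-isInv-new c zero P))
                              (+-comm (count (eligible c zero) P) (dinv P)))

module _ {a ℓ : Level} (R : CommutativeSemiring a ℓ) where
  open CommutativeSemiring R
    using (Carrier; _≈_; 1#; setoid; *-assoc; *-identityˡ; distribˡ; zeroʳ)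
    renaming (_+_ to _⊕_; _*_ to _⊛_; +-cong to ⊕-cong; +-congˡ to ⊕-congˡ; +-congʳ to ⊕-congʳ;
              +-assoc to ⊕-assoc; +-comm to ⊕-comm; *-congˡ to ⊛-congˡ;
              sym to ≈-sym; trans to ≈-trans; reflexive to ≈-reflexive)
  open import Relation.Binary.Reasoning.Setoid setoid

  pow-+ : ∀ x m n → pow R x (m + n) ≈ pow R x m ⊛ pow R x n
  pow-+ x zero    n = ≈-sym (*-identityˡ _)
  pow-+ x (suc m) n = ≈-trans (⊛-congˡ (pow-+ x m n)) (≈-sym (*-assoc _ _ _))

  qint-suc : ∀ q e → qint R q (suc e) ≈ pow R q e ⊕ qint R q e
  qint-suc q zero    = ⊕-congˡ (zeroʳ q)
  qint-suc q (suc e) = begin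
    1# ⊕ q ⊛ qint R q (suc e)                 ≈⟨ ⊕-congˡ (⊛-congˡ (qint-suc q e)) ⟩
    1# ⊕ q ⊛ (pow R q e ⊕ qint R q e)         ≈⟨ ⊕-congˡ (distribˡ q _ _) ⟩
    1# ⊕ (q ⊛ pow R q e ⊕ q ⊛ qint R q e)     ≈⟨ ≈-sym (⊕-assoc _ _ _) ⟩
    (1# ⊕ q ⊛ pow R q e) ⊕ q ⊛ qint R q e     ≈⟨ ⊕-congʳ (⊕-comm _ _) ⟩
    (q ⊛ pow R q e ⊕ 1#) ⊕ q ⊛ qint R q e     ≈⟨ ⊕-assoc _ _ _ ⟩
    q ⊛ pow R q e ⊕ (1# ⊕ q ⊛ qint R q e)     ∎

  geometric-sum : ∀ q N → sumR R (map (pow R q) (downFrom N)) ≈ qint R q N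
  geometric-sum q zero    = ≈-reflexive refl
  geometric-sum q (suc N) = ≈-trans (⊕-congˡ (geometric-sum q N)) (≈-sym (qint-suc q N))

  sumR-map-cong : ∀ {A : Set} {f g : A → Carrier} (xs : List A)
                → (∀ x → f x ≈ g x) → sumR R (map f xs) ≈ sumR R (map g xs)
  sumR-map-cong []       f≈g = ≈-reflexive refl
  sumR-map-cong (x ∷ xs) f≈g = ⊕-cong (f≈g x) (sumR-map-cong xs f≈g)

  sumR-scale : ∀ {A : Set} (y : Carrier) (f : A → Carrier) (xs : List A)
             → sumR R (map (λ x → y ⊛ f x) xs) ≈ y ⊛ sumR R (map f xs)
  sumR-scale y f []       = ≈-sym (zeroʳ y)
  sumR-scale y f (x ∷ xs) = ≈-trans (⊕-congˡ (sumR-scale y f xs)) (≈-sym (distribˡ y _ _))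

  weight : Carrier → Carrier → ℕ × ℕ → Carrier
  weight t q (A , D) = pow R t A ⊛ pow R q D

  gf-consecutive-dinv : ∀ t q (L : List (List Row)) A D N
    → map stats L ≡ map (λ i → A , D + i) (downFrom N)
    → areaDinvGF R t q L ≈ (pow R t A ⊛ pow R q D) ⊛ qint R q (length L)
  gf-consecutive-dinv t q L A D N statsL = begin
    areaDinvGF R t q L                                  ≡⟨ cong (sumR R) (map-∘ L) ⟩
    sumR R (map (weight t q) (map stats L))             ≡⟨ cong (sumR R ∘ map (weight t q)) statsL ⟩
    sumR R (map (weight t q) (map (λ i → A , D + i) is)) ≡⟨ cong (sumR R) (sym (map-∘ is)) ⟩
    sumR R (map (λ i → pow R t A ⊛ pow R q (D + i)) is)
      ≈⟨ sumR-map-cong is (λ i → ≈-trans (⊛-congˡ (pow-+ q D i)) (≈-sym (*-assoc _ _ _))) ⟩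
    sumR R (map (λ i → (pow R t A ⊛ pow R q D) ⊛ pow R q i) is)
      ≈⟨ sumR-scale _ (pow R q) is ⟩
    (pow R t A ⊛ pow R q D) ⊛ sumR R (map (pow R q) is) ≈⟨ ⊛-congˡ (geometric-sum q N) ⟩
    (pow R t A ⊛ pow R q D) ⊛ qint R q N                ≡⟨ cong (λ m → _ ⊛ qint R q m) N≡size ⟩
    (pow R t A ⊛ pow R q D) ⊛ qint R q (length L)       ∎
    where
    is = downFrom N
    N≡size : N ≡ length L
    N≡size = trans (sym (length-downFrom N))
             (trans (sym (length-map (λ i → A , D + i) is))
             (trans (cong length (sym statsL)) (length-map stats L)))

-- Lemma 3.5: the hypotheses say exactly that no row of P forms an inversion
-- with the new row (c , k) above it, so stats-Insert applies.
lemma3p5 : (P : List Row) → IsPF P → (c k : ℕ) → 1 ≤ c → c ∉ map car P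
    → All (λ r → diag r ≢ suc k) P
    → All (λ r → diag r ≡ k → ¬ (car r < c)) P
    → {a ℓ : Level} (R : CommutativeSemiring a ℓ) (t q : CommutativeSemiring.Carrier R)
    → CommutativeSemiring._≈_ R
        (areaDinvGF R t q (Insert P c k))
        (CommutativeSemiring._*_ R
          (CommutativeSemiring._*_ R (pow R t (area P + k)) (pow R q (dinv P)))
          (qint R q (length (Insert P c k))))
lemma3p5 P _ c k _ _ notAbove notSmaller R t q =
  gf-consecutive-dinv R t q (Insert P c k) (area P + k) (dinv P) (proj₁ statsInsert)
                      (proj₂ statsInsert)
  where
  noInvWithNew : All (λ r → isInv r (c , k) ≡ false) P
  noInvWithNew = All.zipWith (λ {r} (above , smaller) → no-inversion-with-new c k r above smaller)
                             (notAbove , notSmaller)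
  statsInsert : ∃ λ N → map stats (Insert P c k)
                        ≡ map (λ i → area P + k , dinv P + i) (downFrom N)
  statsInsert = stats-Insert P c k noInvWithNew
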